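{- Let $G=(V,E)$ be a finite simple graph of order $n$ and $T=n-1$. Let $(x,y,z)$ be an optimal solution of the model minimizing $\sum_{v\in V}x^0_v-\frac{1}{2T}\sum_{t\in[T]}z^t$ over binary variables $x^t_v$ ($v\in V$, $t\in\{0,\ldots,T\}$), $y^t_a$ ($a\in A$, $t\in[T]$), $z^t$ ($t\in[T]$) subject to (1) $x^0_v+\sum_{t\in[T]}\sum_{a=(u,v)\in A}y^t_a=1$ for all $v$; (2) $y^t_a\le x^{t-1}_u$ for all $a=(u,v)\in A$, $t\in[T]$; (3) $y^t_a\le x^{t-1}_w$ for all $a=(u,v)\in A$, $w\in N(u)\setminus\{v\}$, $t\in[T]$; (4) $x^t_v=x^{t-1}_v+\sum_{a=(u,v)\in A}y^t_a$ for all $v$, $t\in[T]$; (5) $x^{t-1}_u-x^{t-1}_v+\sum_{w\in N(u)\setminus\{v\}}x^{t-1}_w\le\sum_{a=(w,v)\in A}y^t_a+\deg(u)-1$ for all $(u,v)\in A$, $t\in[T]$; (6) $\frac1n\sum_{v}(x^t_v-x^{t-1}_v)-z^t\le0$ for all $t\in[T]$; (7) $z^t-\sum_{v}(x^t_v-x^{t-1}_v)\le0$ for all $t\in[T]$. Then $C=\{v\in V: x^0_v=1\}$ is a minimum zero forcing set of $G$ such that $\operatorname{PT}(G)=\operatorname{pt}(G,C)=\sum_{t\in[T]}z^t$.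
   Context: $[T]=\{1,\ldots,T\}$; $N(u)$ is the neighborhood, $\deg(u)=|N(u)|$; $A$ contains both arcs $(u,v),(v,u)$ for each edge. Standard zero forcing rule: a filled vertex $u$ forces a non-filled vertex $v$ if $v$ is the only non-filled neighbor of $u$. A zero forcing set is a set from which repeated forcing fills all vertices; a minimum one has cardinality $Z(G)$. $\operatorname{pt}(G,C)$ is the number of time steps needed to fill all vertices from $C$ when at each step all possible forces are applied simultaneously; the maximum propagation time is $\operatorname{PT}(G)=\max\{\operatorname{pt}(G,C): C\text{ zero forcing set}, |C|=Z(G)\}$. -}

module Defs where

open import Data.Nat as ℕ using (ℕ; zero; suc; _∸_)
open import Data.Integer as ℤ using (ℤ; +_; _+_; _-_; _*_; _≤_)
open import Data.Bool using (Bool; true; false; _∧_; _∨_; not; if_then_else_)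
open import Data.Fin using (Fin; zero; suc; inject₁; _≟_)
open import Data.Product using (Σ; _×_; _,_)
open import Relation.Nullary using (¬_; Dec; yes; no)
open import Relation.Binary.PropositionalEquality using (_≡_; _≢_)

record Graph (n : ℕ) : Set where
  field
    adj     : Fin n → Fin n → Bool
    sym     : ∀ u v → adj u v ≡ adj v u
    irrefl  : ∀ u → adj u u ≡ false

open Graph public

sumℤ : ∀ {n} → (Fin n → ℤ) → ℤ
sumℤ {zero}  f = + 0
sumℤ {suc n} f = f zero + sumℤ (λ i → f (suc i))

sumℕ : ∀ {n} → (Fin n → ℕ) → ℕ
sumℕ {zero}  f = 0
sumℕ {suc n} f = f zero ℕ.+ sumℕ (λ i → f (suc i))

anyB : ∀ {n} → (Fin n → Bool) → Bool
anyB {zero}  f = false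
anyB {suc n} f = f zero ∨ anyB (λ i → f (suc i))

allB : ∀ {n} → (Fin n → Bool) → Bool
allB {zero}  f = true
allB {suc n} f = f zero ∧ allB (λ i → f (suc i))

⟦_⟧ : Bool → ℤ
⟦ true ⟧  = + 1
⟦ false ⟧ = + 0

⟦_⟧ℕ : Bool → ℕ
⟦ true ⟧ℕ  = 1
⟦ false ⟧ℕ = 0

eqB : ∀ {n} → Fin n → Fin n → Bool
eqB i j with i ≟ j
... | yes _ = true
... | no  _ = false

deg : ∀ {n} → Graph n → Fin n → ℕ
deg G u = sumℕ (λ w → ⟦ adj G u w ⟧ℕ)

VSet : ℕ → Set
VSet n = Fin n → Bool

card : ∀ {n} → VSet n → ℕ
card S = sumℕ (λ v → ⟦ S v ⟧ℕ)

canForce : ∀ {n} → Graph n → VSet n → Fin n → Fin n → Bool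
canForce G S u v =
  S u ∧ not (S v) ∧ adj G u v ∧
  allB (λ w → not (adj G u w) ∨ eqB w v ∨ S w)

-- one time step: all possible forces applied simultaneously
step : ∀ {n} → Graph n → VSet n → VSet n
step G S v = S v ∨ anyB (λ u → canForce G S u v)

iter : ∀ {n} → Graph n → ℕ → VSet n → VSet n
iter G zero    S = S
iter G (suc k) S = step G (iter G k S)

AllFilled : ∀ {n} → VSet n → Set
AllFilled S = ∀ v → S v ≡ true

IsZFS : ∀ {n} → Graph n → VSet n → Set
IsZFS G C = Σ ℕ λ k → AllFilled (iter G k C)

IsMinZFS : ∀ {n} → Graph n → VSet n → Set
IsMinZFS G C = IsZFS G C × (∀ D → IsZFS G D → card C ℕ.≤ card D)

IsPt : ∀ {n} → Graph n → VSet n → ℕ → Set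
IsPt G C k = AllFilled (iter G k C) × (∀ j → j ℕ.< k → ¬ AllFilled (iter G j C))

IsPT : ∀ {n} → Graph n → ℕ → Set
IsPT G m =
  (Σ (VSet _) λ C → IsMinZFS G C × IsPt G C m) ×
  (∀ D k → IsMinZFS G D → IsPt G D k → k ℕ.≤ m)

-- The integer programming model, with T = n - 1.
-- x t v  : x^t_v,  t ∈ {0..T}  (t : Fin (suc T))
-- y t u v : y^{t+1}_{(u,v)}, t : Fin T stands for time t+1 ∈ [T]
--           (only used for arcs, i.e. when adj u v ≡ true)
-- z t    : z^{t+1}

module _ {n : ℕ} (G : Graph n) where

  T : ℕ
  T = n ∸ 1

  XVar : Set
  XVar = Fin (suc T) → Fin n → Bool

  YVar : Set
  YVar = Fin T → Fin n → Fin n → Bool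

  ZVar : Set
  ZVar = Fin T → Bool

  -- x^{t-1} and x^t for t ∈ [T] represented by t : Fin T
  prev : XVar → Fin T → Fin n → Bool
  prev x t = x (inject₁ t)

  cur : XVar → Fin T → Fin n → Bool
  cur x t = x (suc t)

  inflow : YVar → Fin T → Fin n → ℤ
  inflow y t v = sumℤ (λ u → if adj G u v then ⟦ y t u v ⟧ else + 0)

  record Feasible (x : XVar) (y : YVar) (z : ZVar) : Set where
    field
      c1 : ∀ v → ⟦ x zero v ⟧ + sumℤ (λ t → inflow y t v) ≡ + 1
      c2 : ∀ t u v → adj G u v ≡ true → ⟦ y t u v ⟧ ≤ ⟦ prev x t u ⟧
      c3 : ∀ t u v w → adj G u v ≡ true → adj G u w ≡ true → w ≢ v →
           ⟦ y t u v ⟧ ≤ ⟦ prev x t w ⟧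
      c4 : ∀ t v → ⟦ cur x t v ⟧ ≡ ⟦ prev x t v ⟧ + inflow y t v
      c5 : ∀ t u v → adj G u v ≡ true →
           ⟦ prev x t u ⟧ - ⟦ prev x t v ⟧
             + sumℤ (λ w → if adj G u w ∧ not (eqB w v) then ⟦ prev x t w ⟧ else + 0)
           ≤ inflow y t v + + deg G u - + 1
      -- (6) multiplied by n > 0:  Σ_v (x^t_v - x^{t-1}_v) ≤ n z^t
      c6 : ∀ t → sumℤ (λ v → ⟦ cur x t v ⟧ - ⟦ prev x t v ⟧) ≤ + n * ⟦ z t ⟧
      c7 : ∀ t → ⟦ z t ⟧ ≤ sumℤ (λ v → ⟦ cur x t v ⟧ - ⟦ prev x t v ⟧)

  -- objective multiplied by 2T:  2T Σ_v x^0_v - Σ_t z^t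
  objective : XVar → ZVar → ℤ
  objective x z = + (2 ℕ.* T) * sumℤ (λ v → ⟦ x zero v ⟧) - sumℤ (λ t → ⟦ z t ⟧)

  Optimal : XVar → YVar → ZVar → Set
  Optimal x y z = Feasible x y z ×
    (∀ x′ y′ z′ → Feasible x′ y′ z′ → objective x z ≤ objective x′ z′)

  sumZ : ZVar → ℕ
  sumZ z = sumℕ (λ t → ⟦ z t ⟧ℕ)

{-# OPTIONS --safe #-}
-- Feasible solutions of the model are exactly the runs of the zero forcing process. For a
-- feasible (x, y, z), constraints (2)-(5) force x^t to be the set of vertices filled after t
-- steps from C = x^0, constraint (1) then says that C fills G within T steps, and (6)-(7) make
-- z^t the indicator that the run is unfinished at time t - 1, so that the sum of the z^t is
-- pt(G, C). Conversely every zero forcing set fills G within n - 1 steps and so gives a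
-- feasible solution, with y choosing one forcing vertex for each forced vertex. The objective
-- scaled by 2T is therefore 2T|C| - pt(G, C), and since 0 <= pt <= T < 2T an optimum first
-- minimises |C| and then maximises pt(G, C) among minimum zero forcing sets.
module Submission where

open import Defs hiding (sym)
open import Data.Nat as ℕ using (ℕ; zero; suc; z≤n; s≤s; _≤′_; ≤′-refl; ≤′-step)
import Data.Nat.Properties as ℕP
open import Data.Integer as ℤ using (ℤ; +_; 0ℤ; _+_; _-_; _*_; _≤_; +≤+)
import Data.Integer.Properties as ℤP
open import Data.Integer.Tactic.RingSolver using (solve-∀)
open import Data.Bool using (Bool; true; false; _∧_; _∨_; not; if_then_else_)
import Data.Bool.Properties as BoolP
open import Data.Fin using (Fin; zero; suc; inject₁; fromℕ; toℕ; _≟_)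
import Data.Fin.Properties as FinP
open import Data.Product using (_×_; _,_; proj₁; proj₂; ∃)
open import Data.Sum using (_⊎_; inj₁; inj₂)
open import Function using (_∘_)
open import Function.Bundles using (_⇔_; mk⇔; Equivalence)
open import Relation.Nullary using (¬_; yes; no; contradiction)
open import Relation.Binary.PropositionalEquality
open import Algebra.Properties.CommutativeSemigroup ℕP.+-commutativeSemigroup using (interchange)

true⇔true⇒≡ : ∀ {b c} → (b ≡ true → c ≡ true) → (c ≡ true → b ≡ true) → b ≡ c
true⇔true⇒≡ {false} {false} _ _ = refl
true⇔true⇒≡ {false} {true}  _ c⇒b = c⇒b refl
true⇔true⇒≡ {true}  b⇒c _ = sym (b⇒c refl)

∧≡true : ∀ {a b} → a ∧ b ≡ true → a ≡ true × b ≡ true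
∧≡true {true} b≡true = refl , b≡true

∨≡true : ∀ {a b} → a ∨ b ≡ true → a ≡ true ⊎ b ≡ true
∨≡true {true}  _      = inj₁ refl
∨≡true {false} b≡true = inj₂ b≡true

⟦⟧≡+⟦⟧ℕ : ∀ b → ⟦ b ⟧ ≡ + ⟦ b ⟧ℕ
⟦⟧≡+⟦⟧ℕ true  = refl
⟦⟧≡+⟦⟧ℕ false = refl

1≤⟦⟧ℕ⇒true : ∀ {b} → 1 ℕ.≤ ⟦ b ⟧ℕ → b ≡ true
1≤⟦⟧ℕ⇒true {true} _ = refl

⟦⟧ℕ-mono : ∀ {b c} → (b ≡ true → c ≡ true) → ⟦ b ⟧ℕ ℕ.≤ ⟦ c ⟧ℕ
⟦⟧ℕ-mono {false} _   = z≤n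
⟦⟧ℕ-mono {true}  b⇒c rewrite b⇒c refl = s≤s z≤n

⟦⟧-mono : ∀ {b c} → (b ≡ true → c ≡ true) → ⟦ b ⟧ ≤ ⟦ c ⟧
⟦⟧-mono {b} {c} b⇒c rewrite ⟦⟧≡+⟦⟧ℕ b | ⟦⟧≡+⟦⟧ℕ c = +≤+ (⟦⟧ℕ-mono b⇒c)

⟦⟧-mono⁻¹ : ∀ {b c} → ⟦ b ⟧ ≤ ⟦ c ⟧ → b ≡ true → c ≡ true
⟦⟧-mono⁻¹ {true} {true} _ _ = refl
⟦⟧-mono⁻¹ {true} {false} (+≤+ ()) _

⟦⟧≡+1⇒true : ∀ {b} → ⟦ b ⟧ ≡ + 1 → b ≡ true
⟦⟧≡+1⇒true {true} _ = refl

⟦∨⟧ℕ : ∀ a b → (a ≡ true → b ≡ false) → ⟦ a ∨ b ⟧ℕ ≡ ⟦ a ⟧ℕ ℕ.+ ⟦ b ⟧ℕ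
⟦∨⟧ℕ true  b a⇒¬b = cong (suc ∘ ⟦_⟧ℕ) (sym (a⇒¬b refl))
⟦∨⟧ℕ false b _    = refl

∧-absorbˡ : ∀ {a b} → (b ≡ true → a ≡ true) → a ∧ b ≡ b
∧-absorbˡ {true}          _   = refl
∧-absorbˡ {false} {false} _   = refl
∧-absorbˡ {false} {true}  b⇒a = b⇒a refl

⟦⟧ℕ-partition : ∀ a e s → ⟦ a ⟧ℕ ≡ ⟦ a ∧ e ⟧ℕ ℕ.+ ⟦ (a ∧ not e) ∧ s ⟧ℕ ℕ.+ ⟦ not (not a ∨ e ∨ s) ⟧ℕ
⟦⟧ℕ-partition false _     _     = refl
⟦⟧ℕ-partition true  true  _     = refl
⟦⟧ℕ-partition true  false true  = refl
⟦⟧ℕ-partition true  false false = refl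

⟦⟧ℕ-cover : ∀ a b d c → d ≡ true → ⟦ a ⟧ℕ ℕ.≤ ⟦ a ∧ not b ∧ d ∧ c ⟧ℕ ℕ.+ ⟦ not c ⟧ℕ ℕ.+ ⟦ b ⟧ℕ
⟦⟧ℕ-cover false _     _ _     _    = z≤n
⟦⟧ℕ-cover true  true  _ c     _    = ℕP.m≤n+m 1 ⟦ not c ⟧ℕ
⟦⟧ℕ-cover true  false _ true  refl = s≤s z≤n
⟦⟧ℕ-cover true  false _ false refl = s≤s z≤n

if-⟦⟧ : ∀ a b → (if a then ⟦ b ⟧ else + 0) ≡ + ⟦ a ∧ b ⟧ℕ
if-⟦⟧ true  b = ⟦⟧≡+⟦⟧ℕ b
if-⟦⟧ false b = refl

eqB-refl : ∀ {n} (i : Fin n) → eqB i i ≡ true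
eqB-refl i with i ≟ i
... | yes _   = refl
... | no  i≢i = contradiction refl i≢i

eqB-≢ : ∀ {n} {i j : Fin n} → i ≢ j → eqB i j ≡ false
eqB-≢ {i = i} {j} i≢j with i ≟ j
... | yes i≡j = contradiction i≡j i≢j
... | no  _   = refl

sumℕ-cong : ∀ {n} {f g : Fin n → ℕ} → f ≗ g → sumℕ f ≡ sumℕ g
sumℕ-cong {zero}  f≗g = refl
sumℕ-cong {suc n} f≗g = cong₂ ℕ._+_ (f≗g zero) (sumℕ-cong (f≗g ∘ suc))

sumℤ-cong : ∀ {n} {f g : Fin n → ℤ} → f ≗ g → sumℤ f ≡ sumℤ g
sumℤ-cong {zero}  f≗g = refl
sumℤ-cong {suc n} f≗g = cong₂ _+_ (f≗g zero) (sumℤ-cong (f≗g ∘ suc))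

sumℤ-pos : ∀ {n} (f : Fin n → ℕ) → sumℤ (+_ ∘ f) ≡ + sumℕ f
sumℤ-pos {zero}  f = refl
sumℤ-pos {suc n} f = trans (cong (λ s → + f zero + s) (sumℤ-pos (f ∘ suc))) (sym (ℤP.pos-+ (f zero) _))

sumℤ-⟦⟧ : ∀ {n} (f : Fin n → Bool) → sumℤ (λ i → ⟦ f i ⟧) ≡ + card f
sumℤ-⟦⟧ f = trans (sumℤ-cong (⟦⟧≡+⟦⟧ℕ ∘ f)) (sumℤ-pos (⟦_⟧ℕ ∘ f))

sumℕ-+ : ∀ {n} (f g : Fin n → ℕ) → sumℕ (λ i → f i ℕ.+ g i) ≡ sumℕ f ℕ.+ sumℕ g
sumℕ-+ {zero}  f g = refl
sumℕ-+ {suc n} f g = trans (cong (f zero ℕ.+ g zero ℕ.+_) (sumℕ-+ (f ∘ suc) (g ∘ suc)))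
                           (interchange (f zero) (g zero) (sumℕ (f ∘ suc)) (sumℕ (g ∘ suc)))

sumℕ-mono : ∀ {n} {f g : Fin n → ℕ} → (∀ i → f i ℕ.≤ g i) → sumℕ f ℕ.≤ sumℕ g
sumℕ-mono {zero}  f≤g = z≤n
sumℕ-mono {suc n} f≤g = ℕP.+-mono-≤ (f≤g zero) (sumℕ-mono (f≤g ∘ suc))

sumℕ-mono-< : ∀ {n} {f g : Fin n → ℕ} → (∀ i → f i ℕ.≤ g i) → ∀ j → f j ℕ.< g j → sumℕ f ℕ.< sumℕ g
sumℕ-mono-< {suc n} f≤g zero    fj<gj = ℕP.+-mono-<-≤ fj<gj (sumℕ-mono (f≤g ∘ suc))
sumℕ-mono-< {suc n} f≤g (suc j) fj<gj = ℕP.+-mono-≤-< (f≤g zero) (sumℕ-mono-< (f≤g ∘ suc) j fj<gj)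

term≤sumℕ : ∀ {n} (f : Fin n → ℕ) j → f j ℕ.≤ sumℕ f
term≤sumℕ f zero    = ℕP.m≤m+n (f zero) _
term≤sumℕ f (suc j) = ℕP.≤-trans (term≤sumℕ (f ∘ suc) j) (ℕP.m≤n+m _ (f zero))

sumℕ-zero : ∀ {n} {f : Fin n → ℕ} → (∀ i → f i ≡ 0) → sumℕ f ≡ 0
sumℕ-zero {zero}  f≡0 = refl
sumℕ-zero {suc n} f≡0 = cong₂ ℕ._+_ (f≡0 zero) (sumℕ-zero (f≡0 ∘ suc))

sumℕ-single : ∀ {n} {f : Fin n → ℕ} j → (∀ i → i ≢ j → f i ≡ 0) → sumℕ f ≡ f j
sumℕ-single {suc n} {f} zero f≡0 =
  trans (cong (f zero ℕ.+_) (sumℕ-zero (λ i → f≡0 (suc i) λ ()))) (ℕP.+-identityʳ _)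
sumℕ-single {suc n} (suc j) f≡0 =
  cong₂ ℕ._+_ (f≡0 zero λ ()) (sumℕ-single j (λ i i≢j → f≡0 (suc i) (i≢j ∘ FinP.suc-injective)))

sumℕ-positive : ∀ {n} (f : Fin n → ℕ) → 1 ℕ.≤ sumℕ f → ∃ λ i → 1 ℕ.≤ f i
sumℕ-positive {suc n} f 1≤sum with f zero in f0≡
... | suc _ = zero , subst (1 ℕ.≤_) (sym f0≡) (s≤s z≤n)
... | zero with sumℕ-positive (f ∘ suc) 1≤sum
...   | i , 1≤fi = suc i , 1≤fi

anyB-intro : ∀ {n} (f : Fin n → Bool) i → f i ≡ true → anyB f ≡ true
anyB-intro f zero    fi≡true rewrite fi≡true = refl
anyB-intro f (suc i) fi≡true = trans (cong (f zero ∨_) (anyB-intro (f ∘ suc) i fi≡true)) (BoolP.∨-zeroʳ _)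

anyB-elim : ∀ {n} (f : Fin n → Bool) → anyB f ≡ true → ∃ λ i → f i ≡ true
anyB-elim {suc n} f any≡true with ∨≡true {f zero} any≡true
... | inj₁ f0≡true = zero , f0≡true
... | inj₂ rest    = let i , fi≡true = anyB-elim (f ∘ suc) rest in suc i , fi≡true

allB-elim : ∀ {n} (f : Fin n → Bool) → allB f ≡ true → ∀ i → f i ≡ true
allB-elim f all≡true zero    = proj₁ (∧≡true all≡true)
allB-elim f all≡true (suc i) = allB-elim (f ∘ suc) (proj₂ (∧≡true {f zero} all≡true)) i

allB-intro : ∀ {n} (f : Fin n → Bool) → (∀ i → f i ≡ true) → allB f ≡ true
allB-intro {zero}  f all = refl
allB-intro {suc n} f all rewrite all zero = allB-intro (f ∘ suc) (all ∘ suc)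

anyB-cong : ∀ {n} {f g : Fin n → Bool} → f ≗ g → anyB f ≡ anyB g
anyB-cong {zero}  f≗g = refl
anyB-cong {suc n} f≗g = cong₂ _∨_ (f≗g zero) (anyB-cong (f≗g ∘ suc))

allB-cong : ∀ {n} {f g : Fin n → Bool} → f ≗ g → allB f ≡ allB g
allB-cong {zero}  f≗g = refl
allB-cong {suc n} f≗g = cong₂ _∧_ (f≗g zero) (allB-cong (f≗g ∘ suc))

⟦not-allB⟧≤count : ∀ {n} (f : Fin n → Bool) → ⟦ not (allB f) ⟧ℕ ℕ.≤ sumℕ (λ i → ⟦ not (f i) ⟧ℕ)
⟦not-allB⟧≤count {zero}  f = z≤n
⟦not-allB⟧≤count {suc n} f with f zero
... | true  = ⟦not-allB⟧≤count (f ∘ suc)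
... | false = s≤s z≤n

allB⇒count≡0 : ∀ {n} (f : Fin n → Bool) → allB f ≡ true → sumℕ (λ i → ⟦ not (f i) ⟧ℕ) ≡ 0
allB⇒count≡0 f all≡true = sumℕ-zero (λ i → cong (⟦_⟧ℕ ∘ not) (allB-elim f all≡true i))

firstTrue : ∀ {n} → (Fin n → Bool) → Fin n → Bool
firstTrue f zero    = f zero
firstTrue f (suc i) = not (f zero) ∧ firstTrue (f ∘ suc) i

firstTrue⇒true : ∀ {n} (f : Fin n → Bool) i → firstTrue f i ≡ true → f i ≡ true
firstTrue⇒true f zero    first≡true = first≡true
firstTrue⇒true f (suc i) first≡true = firstTrue⇒true (f ∘ suc) i (proj₂ (∧≡true {not (f zero)} first≡true))

sumℕ-firstTrue : ∀ {n} (f : Fin n → Bool) → sumℕ (λ i → ⟦ firstTrue f i ⟧ℕ) ≡ ⟦ anyB f ⟧ℕ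
sumℕ-firstTrue {zero}  f = refl
sumℕ-firstTrue {suc n} f with f zero
... | true  = cong suc (sumℕ-zero {n} (λ _ → refl))
... | false = sumℕ-firstTrue (f ∘ suc)

_⊆_ : ∀ {n} → VSet n → VSet n → Set
S ⊆ S′ = ∀ v → S v ≡ true → S′ v ≡ true

card-all : ∀ n → card {n} (λ _ → true) ≡ n
card-all zero    = refl
card-all (suc n) = cong suc (card-all n)

card-full : ∀ {n} (S : VSet n) → AllFilled S → card S ≡ n
card-full {n} S full = trans (sumℕ-cong (cong ⟦_⟧ℕ ∘ full)) (card-all n)

card-mono : ∀ {n} {S S′ : VSet n} → S ⊆ S′ → card S ℕ.≤ card S′
card-mono S⊆S′ = sumℕ-mono (λ v → ⟦⟧ℕ-mono (S⊆S′ v))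

card-mono-< : ∀ {n} {S S′ : VSet n} → S ⊆ S′ → ∀ w → S w ≡ false → S′ w ≡ true → card S ℕ.< card S′
card-mono-< S⊆S′ w Sw≡false S′w≡true = sumℕ-mono-< (λ v → ⟦⟧ℕ-mono (S⊆S′ v)) w
  (subst₂ (λ b c → ⟦ b ⟧ℕ ℕ.< ⟦ c ⟧ℕ) (sym Sw≡false) (sym S′w≡true) (s≤s z≤n))

card≤n : ∀ {n} (S : VSet n) → card S ℕ.≤ n
card≤n {n} S = subst (card S ℕ.≤_) (card-all n) (card-mono {S = S} (λ _ _ → refl))

card<n : ∀ {n} (S : VSet n) w → S w ≡ false → card S ℕ.< n
card<n {n} S w Sw≡false =
  subst (card S ℕ.<_) (card-all n) (card-mono-< {S = S} (λ _ _ → refl) w Sw≡false refl)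

1≤card : ∀ {n} (S : VSet n) v → S v ≡ true → 1 ℕ.≤ card S
1≤card S v Sv≡true = ℕP.≤-trans (ℕP.≤-reflexive (cong ⟦_⟧ℕ (sym Sv≡true))) (term≤sumℕ _ v)

≤⇔difference : ∀ (a b : ℤ) p q → b - a ≡ + p - + q → (a ≤ b ⇔ q ℕ.≤ p)
≤⇔difference a b p q b-a≡ = mk⇔
  (λ a≤b → ℤP.drop‿+≤+ (ℤP.0≤i-j⇒j≤i (subst (0ℤ ≤_) b-a≡ (ℤP.i≤j⇒0≤j-i a≤b))))
  (λ q≤p → ℤP.0≤i-j⇒j≤i (subst (0ℤ ≤_) (sym b-a≡) (ℤP.i≤j⇒0≤j-i (+≤+ q≤p))))

pos-+₃ : ∀ a b c → + (a ℕ.+ b ℕ.+ c) ≡ + a + + b + + c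
pos-+₃ a b c = trans (ℤP.pos-+ (a ℕ.+ b) c) (cong (_+ + c) (ℤP.pos-+ a b))

+[m+n]-+m : ∀ m n → + (m ℕ.+ n) - + m ≡ + n
+[m+n]-+m m n = trans (cong (_- + m) (ℤP.pos-+ m n)) (cancel (+ m) (+ n))
  where
  cancel : ∀ M N → M + N - M ≡ N
  cancel = solve-∀

telescope : ∀ {m} (g : Fin (suc m) → ℤ) (d : Fin m → ℤ) →
  (∀ t → g (suc t) ≡ g (inject₁ t) + d t) → g (fromℕ m) ≡ g zero + sumℤ d
telescope {zero}  g d step-g = sym (ℤP.+-identityʳ (g zero))
telescope {suc m} g d step-g = begin
  g (fromℕ (suc m))                ≡⟨ telescope (g ∘ suc) (d ∘ suc) (step-g ∘ suc) ⟩
  g (suc zero) + sumℤ (d ∘ suc)     ≡⟨ cong (_+ sumℤ (d ∘ suc)) (step-g zero) ⟩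
  g zero + d zero + sumℤ (d ∘ suc)  ≡⟨ ℤP.+-assoc (g zero) (d zero) _ ⟩
  g zero + sumℤ d                   ∎
  where open ≡-Reasoning

weighted-≤ : ∀ K {c d s s′} → s ℕ.< K → K ℕ.* c ℕ.+ s′ ℕ.≤ K ℕ.* d ℕ.+ s → c ℕ.≤ d
weighted-≤ K {c} {d} {s} {s′} s<K Kc+s′≤Kd+s = ℕP.≮⇒≥ λ d<c → ℕP.<-irrefl refl (begin-strict
  K ℕ.* d ℕ.+ K   ≡⟨ ℕP.+-comm (K ℕ.* d) K ⟩
  K ℕ.+ K ℕ.* d   ≡⟨ ℕP.*-suc K d ⟨
  K ℕ.* suc d     ≤⟨ ℕP.*-monoʳ-≤ K d<c ⟩
  K ℕ.* c         ≤⟨ ℕP.m≤m+n (K ℕ.* c) s′ ⟩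
  K ℕ.* c ℕ.+ s′  ≤⟨ Kc+s′≤Kd+s ⟩
  K ℕ.* d ℕ.+ s   <⟨ ℕP.+-monoʳ-< (K ℕ.* d) s<K ⟩
  K ℕ.* d ℕ.+ K   ∎)
  where open ℕP.≤-Reasoning

IsFirstTrue : (ℕ → Bool) → ℕ → Set
IsFirstTrue f c = f c ≡ true × (∀ j → j ℕ.< c → f j ≡ false)

countFalse : (ℕ → Bool) → ℕ → ℕ
countFalse f m = sumℕ {m} (λ t → ⟦ not (f (toℕ t)) ⟧ℕ)

countFalse-isFirstTrue : ∀ f m → (∀ k → f k ≡ true → f (suc k) ≡ true) → f m ≡ true →
  IsFirstTrue f (countFalse f m)
countFalse-isFirstTrue f zero    mono fm≡true = fm≡true , λ _ ()
countFalse-isFirstTrue f (suc m) mono fm≡true with f 0 in f0≡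
... | true  = subst (IsFirstTrue f) (sym tail≡0) (f0≡ , λ _ ())
  where
  always : ∀ k → f k ≡ true
  always zero    = f0≡
  always (suc k) = mono k (always k)
  tail≡0 : countFalse (f ∘ suc) m ≡ 0
  tail≡0 = sumℕ-zero {m} (λ t → cong (⟦_⟧ℕ ∘ not) (always (suc (toℕ t))))
... | false = proj₁ first-of-tail , before
  where
  first-of-tail : IsFirstTrue (f ∘ suc) (countFalse (f ∘ suc) m)
  first-of-tail = countFalse-isFirstTrue (f ∘ suc) m (mono ∘ suc) fm≡true
  before : ∀ j → j ℕ.< suc (countFalse (f ∘ suc) m) → f j ≡ false
  before zero    _         = f0≡
  before (suc j) (s≤s j<c) = proj₂ first-of-tail j j<c

indicator-sandwich : ∀ {m k} (b c : Bool) → (c ≡ false → k ≡ 0) → (c ≡ true → 1 ℕ.≤ k × k ℕ.≤ m) →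
  (+ k ≤ + m * ⟦ b ⟧ × ⟦ b ⟧ ≤ + k) ⇔ b ≡ c
indicator-sandwich {m} {k} false false k≡0 _ = mk⇔ (λ _ → refl) (λ _ → k≤0 , +≤+ z≤n)
  where
  k≤0 : + k ≤ + m * + 0
  k≤0 = subst₂ (λ i j → + i ≤ j) (sym (k≡0 refl)) (sym (ℤP.*-zeroʳ (+ m))) (+≤+ z≤n)
indicator-sandwich {m} {k} true false k≡0 _ = mk⇔ absurd λ ()
  where
  absurd : + k ≤ + m * + 1 × + 1 ≤ + k → true ≡ false
  absurd (_ , 1≤k) = contradiction (subst (1 ℕ.≤_) (k≡0 refl) (ℤP.drop‿+≤+ 1≤k)) λ ()
indicator-sandwich {m} {k} false true _ k-range = mk⇔ absurd λ ()
  where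
  absurd : + k ≤ + m * + 0 × + 0 ≤ + k → false ≡ true
  absurd (k≤0 , _) = contradiction (ℤP.drop‿+≤+ (subst (+ k ≤_) (ℤP.*-zeroʳ (+ m)) k≤0))
                                   (ℕP.<⇒≱ (proj₁ (k-range refl)))
indicator-sandwich {m} {k} true true _ k-range = mk⇔ (λ _ → refl) (λ _ → k≤m , +≤+ (proj₁ (k-range refl)))
  where
  k≤m : + k ≤ + m * + 1
  k≤m = subst (+ k ≤_) (sym (ℤP.*-identityʳ (+ m))) (+≤+ (proj₂ (k-range refl)))

objective-≤⇒ : ∀ K a s b s′ → + K * + a - + s ≤ + K * + b - + s′ → K ℕ.* a ℕ.+ s′ ℕ.≤ K ℕ.* b ℕ.+ s
objective-≤⇒ K a s b s′ = Equivalence.to (≤⇔difference _ _ _ _ (begin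
  + K * + b - + s′ - (+ K * + a - + s)    ≡⟨ rearrange (+ K * + b) (+ K * + a) (+ s) (+ s′) ⟩
  (+ K * + b + + s) - (+ K * + a + + s′)  ≡⟨ cong₂ _-_ (pos-linear b s) (pos-linear a s′) ⟨
  + (K ℕ.* b ℕ.+ s) - + (K ℕ.* a ℕ.+ s′)  ∎))
  where
  open ≡-Reasoning
  rearrange : ∀ B A S S′ → B - S′ - (A - S) ≡ (B + S) - (A + S′)
  rearrange = solve-∀
  pos-linear : ∀ c t → + (K ℕ.* c ℕ.+ t) ≡ + K * + c + + t
  pos-linear c t = trans (ℤP.pos-+ (K ℕ.* c) t) (cong (_+ + t) (ℤP.pos-* K c))

module ZeroForcing {n : ℕ} (G : Graph n) where

  unblocked : VSet n → Fin n → Fin n → Fin n → Bool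
  unblocked S u v w = not (adj G u w) ∨ eqB w v ∨ S w

  blockers : VSet n → Fin n → Fin n → ℕ
  blockers S u v = sumℕ (λ w → ⟦ not (unblocked S u v w) ⟧ℕ)

  filledOthers : VSet n → Fin n → Fin n → ℕ
  filledOthers S u v = sumℕ (λ w → ⟦ (adj G u w ∧ not (eqB w v)) ∧ S w ⟧ℕ)

  isForced : VSet n → Fin n → Bool
  isForced S v = anyB (λ u → canForce G S u v)

  record Forcing (S : VSet n) (u v : Fin n) : Set where
    field
      filled       : S u ≡ true
      unfilled     : S v ≡ false
      adjacent     : adj G u v ≡ true
      allUnblocked : allB (unblocked S u v) ≡ true

  canForce⇒ : ∀ S u v → canForce G S u v ≡ true → Forcing S u v
  canForce⇒ S u v cf =
    let Su , cf₁    = ∧≡true {S u} cf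
        ¬Sv , cf₂   = ∧≡true {not (S v)} cf₁
        auv , ready = ∧≡true {adj G u v} cf₂
    in record { filled = Su ; unfilled = BoolP.not-injective {S v} {false} ¬Sv
              ; adjacent = auv ; allUnblocked = ready }

  allUnblocked⇒filled : ∀ S u v → allB (unblocked S u v) ≡ true →
    ∀ w → adj G u w ≡ true → w ≢ v → S w ≡ true
  allUnblocked⇒filled S u v ready w auw w≢v =
    trans (sym (cong₂ (λ a e → not a ∨ e ∨ S w) auw (eqB-≢ w≢v))) (allB-elim (unblocked S u v) ready w)

  canForce-intro : ∀ S u v → S u ≡ true → S v ≡ false → adj G u v ≡ true →
    (∀ w → adj G u w ≡ true → w ≢ v → S w ≡ true) → canForce G S u v ≡ true
  canForce-intro S u v Su Sv auv filled rewrite Su | Sv | auv = allB-intro _ unblocked-at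
    where
    unblocked-at : ∀ w → unblocked S u v w ≡ true
    unblocked-at w with adj G u w in auw | w ≟ v
    ... | false | _        = refl
    ... | true  | yes refl = refl
    ... | true  | no w≢v   = filled w auw w≢v

  isForced⇒unfilled : ∀ S v → isForced S v ≡ true → S v ≡ false
  isForced⇒unfilled S v forced =
    let u , cf = anyB-elim (λ u → canForce G S u v) forced in Forcing.unfilled (canForce⇒ S u v cf)

  filled⇒¬isForced : ∀ S v → S v ≡ true → isForced S v ≡ false
  filled⇒¬isForced S v Sv =
    BoolP.¬-not λ forced → contradiction (trans (sym Sv) (isForced⇒unfilled S v forced)) λ ()

  ⟦step⟧ℕ : ∀ S v → ⟦ step G S v ⟧ℕ ≡ ⟦ S v ⟧ℕ ℕ.+ ⟦ isForced S v ⟧ℕ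
  ⟦step⟧ℕ S v = ⟦∨⟧ℕ (S v) (isForced S v) (filled⇒¬isForced S v)

  step-inflationary : ∀ S → S ⊆ step G S
  step-inflationary S v Sv = cong (_∨ isForced S v) Sv

  isForced⇒stepped : ∀ S v → isForced S v ≡ true → step G S v ≡ true
  isForced⇒stepped S v forced = trans (cong (S v ∨_) forced) (BoolP.∨-zeroʳ (S v))

  newly-filled⇒isForced : ∀ S v → S v ≡ false → step G S v ≡ true → isForced S v ≡ true
  newly-filled⇒isForced S v Sv stepped = subst (λ b → b ∨ isForced S v ≡ true) Sv stepped

  canForce-cong : ∀ {S S′} → S ≗ S′ → ∀ u v → canForce G S u v ≡ canForce G S′ u v
  canForce-cong S≗S′ u v =
    cong₂ _∧_ (S≗S′ u) (cong₂ _∧_ (cong not (S≗S′ v)) (cong (adj G u v ∧_)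
      (allB-cong (λ w → cong (λ b → not (adj G u w) ∨ eqB w v ∨ b) (S≗S′ w)))))

  step-cong : ∀ {S S′} → S ≗ S′ → step G S ≗ step G S′
  step-cong S≗S′ v = cong₂ _∨_ (S≗S′ v) (anyB-cong (λ u → canForce-cong S≗S′ u v))

  step-sequence≗iter : ∀ {m} (X : Fin (suc m) → VSet n) →
    (∀ t → X (suc t) ≗ step G (X (inject₁ t))) → ∀ k → X k ≗ iter G (toℕ k) (X zero)
  step-sequence≗iter         X X-step zero    v = refl
  step-sequence≗iter {suc m} X X-step (suc t) v =
    trans (X-step t v) (step-cong (step-sequence≗iter (X ∘ inject₁) (X-step ∘ inject₁) t) v)

  iter-+ : ∀ j k S → iter G (j ℕ.+ k) S ≡ iter G j (iter G k S)
  iter-+ zero    k S = refl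
  iter-+ (suc j) k S = cong (step G) (iter-+ j k S)

  iter-stationary : ∀ {S} → step G S ≗ S → ∀ j → iter G j S ≗ S
  iter-stationary stationary zero    v = refl
  iter-stationary stationary (suc j) v = trans (step-cong (iter-stationary stationary j) v) (stationary v)

  AllFilled-step : ∀ {S} → AllFilled S → AllFilled (step G S)
  AllFilled-step {S} full v = step-inflationary S v (full v)

  AllFilled-iter-mono : ∀ {S k m} → k ℕ.≤ m → AllFilled (iter G k S) → AllFilled (iter G m S)
  AllFilled-iter-mono {S} {k} k≤m full = go (ℕP.≤⇒≤′ k≤m)
    where
    go : ∀ {m} → k ≤′ m → AllFilled (iter G m S)
    go ≤′-refl          = full
    go (≤′-step k≤′m) = AllFilled-step (go k≤′m)

  progress : ∀ {C t} → IsZFS G C → ¬ AllFilled (iter G t C) →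
    ∃ λ v → iter G t C v ≡ false × iter G (suc t) C v ≡ true
  progress {C} {t} (K , full-K) not-full with FinP.any? (λ v → isForced (iter G t C) v BoolP.≟ true)
  ... | yes (v , forced) = v , isForced⇒unfilled (iter G t C) v forced , isForced⇒stepped (iter G t C) v forced
  ... | no  none         = contradiction full not-full
    where
    P : VSet n
    P = iter G t C
    stationary : step G P ≗ P
    stationary v =
      trans (cong (P v ∨_) (BoolP.¬-not (λ forced → none (v , forced)))) (BoolP.∨-identityʳ (P v))
    full : AllFilled P
    full v = trans (sym (iter-stationary stationary K v))
                   (subst (λ S → S v ≡ true) (iter-+ K t C) (AllFilled-iter-mono (ℕP.m≤m+n K t) full-K v))

  card+steps≤card-iter : ∀ {D} → IsZFS G D → ∀ k → ¬ AllFilled (iter G k D) →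
    card D ℕ.+ k ℕ.≤ card (iter G k D)
  card+steps≤card-iter {D} D-zfs zero    _        = ℕP.≤-reflexive (ℕP.+-identityʳ (card D))
  card+steps≤card-iter {D} D-zfs (suc k) not-full with progress {t = k} D-zfs (not-full ∘ AllFilled-step)
  ... | v , unfilled , filled-next = begin
    card D ℕ.+ suc k          ≡⟨ ℕP.+-suc (card D) k ⟩
    suc (card D ℕ.+ k)        ≤⟨ s≤s (card+steps≤card-iter D-zfs k (not-full ∘ AllFilled-step)) ⟩
    suc (card (iter G k D))   ≤⟨ card-mono-< (step-inflationary (iter G k D)) v unfilled filled-next ⟩
    card (iter G (suc k) D)   ∎
    where open ℕP.≤-Reasoning

  zfs-nonempty : ∀ {D} → IsZFS G D → ¬ AllFilled D → ∃ λ u → D u ≡ true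
  zfs-nonempty {D} D-zfs not-full with progress {t = 0} D-zfs not-full
  ... | v , unfilled , filled-next =
    let u , cf = anyB-elim (λ u → canForce G D u v) (newly-filled⇒isForced D v unfilled filled-next)
    in u , Forcing.filled (canForce⇒ D u v cf)

  -- A zero forcing set is non-empty and gains a vertex in every step until G is filled.
  zfs-fills-within-T : ∀ {D} → IsZFS G D → AllFilled (iter G (T G) D)
  zfs-fills-within-T {D} D-zfs with FinP.all? (λ v → iter G (T G) D v BoolP.≟ true)
  ... | yes full    = full
  ... | no not-full
    with FinP.¬∀⟶∃¬ n _ (λ v → iter G (T G) D v BoolP.≟ true) not-full
       | zfs-nonempty D-zfs (not-full ∘ AllFilled-iter-mono {m = T G} z≤n)
  ... | v , unfilled | u , Du = contradiction n<n (ℕP.<-irrefl refl)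
    where
    open ℕP.≤-Reasoning
    n<n : n ℕ.< n
    n<n = begin-strict
      n                        ≡⟨ ℕP.m∸n+n≡m (ℕP.≤-trans (s≤s z≤n) (FinP.toℕ<n v)) ⟨
      T G ℕ.+ 1                ≤⟨ ℕP.+-monoʳ-≤ (T G) (1≤card D u Du) ⟩
      T G ℕ.+ card D           ≡⟨ ℕP.+-comm (T G) (card D) ⟩
      card D ℕ.+ T G           ≤⟨ card+steps≤card-iter D-zfs (T G) not-full ⟩
      card (iter G (T G) D)    <⟨ card<n (iter G (T G) D) v (BoolP.¬-not unfilled) ⟩
      n                        ∎

  unfilledSteps : VSet n → ℕ
  unfilledSteps D = countFalse (λ k → allB (iter G k D)) (T G)

  isPt-unfilledSteps : ∀ {D} → AllFilled (iter G (T G) D) → IsPt G D (unfilledSteps D)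
  isPt-unfilledSteps {D} full
    with countFalse-isFirstTrue (λ k → allB (iter G k D)) (T G)
           (λ k filled-k → allB-intro _ (AllFilled-step (allB-elim _ filled-k))) (allB-intro _ full)
  ... | filled-first , unfilled-before =
    allB-elim _ filled-first ,
    λ j j<first full-j → BoolP.not-¬ (unfilled-before j j<first) (allB-intro _ full-j)

  pt-unique : ∀ {D k k′} → IsPt G D k → IsPt G D k′ → k ≡ k′
  pt-unique (full-k , before-k) (full-k′ , before-k′) =
    ℕP.≤-antisym (ℕP.≮⇒≥ (λ k′<k → before-k _ k′<k full-k′))
                 (ℕP.≮⇒≥ (λ k<k′ → before-k′ _ k<k′ full-k))

  deg-split : ∀ S {u v} → adj G u v ≡ true → deg G u ≡ 1 ℕ.+ filledOthers S u v ℕ.+ blockers S u v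
  deg-split S {u} {v} auv = begin
    deg G u
      ≡⟨ sumℕ-cong (λ w → ⟦⟧ℕ-partition (adj G u w) (eqB w v) (S w)) ⟩
    sumℕ (λ w → toV w ℕ.+ filled w ℕ.+ blocked w)
      ≡⟨ sumℕ-+ (λ w → toV w ℕ.+ filled w) blocked ⟩
    sumℕ (λ w → toV w ℕ.+ filled w) ℕ.+ sumℕ blocked
      ≡⟨ cong (ℕ._+ sumℕ blocked) (sumℕ-+ toV filled) ⟩
    sumℕ toV ℕ.+ sumℕ filled ℕ.+ sumℕ blocked
      ≡⟨ cong (λ k → k ℕ.+ sumℕ filled ℕ.+ sumℕ blocked) only-v ⟩
    1 ℕ.+ filledOthers S u v ℕ.+ blockers S u v
      ∎
    where
    open ≡-Reasoning
    toV filled blocked : Fin n → ℕ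
    toV w     = ⟦ adj G u w ∧ eqB w v ⟧ℕ
    filled w  = ⟦ (adj G u w ∧ not (eqB w v)) ∧ S w ⟧ℕ
    blocked w = ⟦ not (unblocked S u v w) ⟧ℕ
    only-v : sumℕ toV ≡ 1
    only-v = trans (sumℕ-single v λ w w≢v →
                      cong ⟦_⟧ℕ (trans (cong (adj G u w ∧_) (eqB-≢ w≢v)) (BoolP.∧-zeroʳ _)))
                   (cong ⟦_⟧ℕ (trans (cong (adj G u v ∧_) (eqB-refl v)) (trans (BoolP.∧-identityʳ _) auv)))

  -- As deg u = 1 + filledOthers + blockers, constraint (5) says: if u is filled, v is not, and u
  -- has no other unfilled neighbour, then some arc into v is used.
  forcing-constraint⇔ : ∀ S {u v} (I : ℤ) (i : ℕ) → I ≡ + i → adj G u v ≡ true →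
    (⟦ S u ⟧ - ⟦ S v ⟧ + sumℤ (λ w → if adj G u w ∧ not (eqB w v) then ⟦ S w ⟧ else + 0)
       ≤ I + + deg G u - + 1)
    ⇔ (⟦ S u ⟧ℕ ℕ.≤ i ℕ.+ blockers S u v ℕ.+ ⟦ S v ⟧ℕ)
  forcing-constraint⇔ S {u} {v} I i I≡i auv = ≤⇔difference _ _ _ _ (begin
    I + + deg G u - + 1 - (⟦ S u ⟧ - ⟦ S v ⟧ + sumℤ others)  ≡⟨ cong₂ _-_ rhs≡ lhs≡ ⟩
    + i + (+ 1 + + f + + b) - + 1 - (+ su - + sv + + f)    ≡⟨ rearrange (+ i) (+ f) (+ b) (+ su) (+ sv) (+ 1) ⟩
    + i + + b + + sv - + su                                ≡⟨ cong (_- + su) (pos-+₃ i b sv) ⟨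
    + (i ℕ.+ b ℕ.+ sv) - + su                              ∎)
    where
    open ≡-Reasoning
    others : Fin n → ℤ
    others w = if adj G u w ∧ not (eqB w v) then ⟦ S w ⟧ else + 0
    f b su sv : ℕ
    f  = filledOthers S u v
    b  = blockers S u v
    su = ⟦ S u ⟧ℕ
    sv = ⟦ S v ⟧ℕ
    rhs≡ : I + + deg G u - + 1 ≡ + i + (+ 1 + + f + + b) - + 1
    rhs≡ = cong₂ (λ J d → J + d - + 1) I≡i (trans (cong +_ (deg-split S auv)) (pos-+₃ 1 f b))
    lhs≡ : ⟦ S u ⟧ - ⟦ S v ⟧ + sumℤ others ≡ + su - + sv + + f
    lhs≡ = cong₂ _+_ (cong₂ _-_ (⟦⟧≡+⟦⟧ℕ (S u)) (⟦⟧≡+⟦⟧ℕ (S v)))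
                     (trans (sumℤ-cong (λ w → if-⟦⟧ (adj G u w ∧ not (eqB w v)) (S w)))
                            (sumℤ-pos (λ w → ⟦ (adj G u w ∧ not (eqB w v)) ∧ S w ⟧ℕ)))
    rearrange : ∀ I F B SU SV O → I + (O + F + B) - O - (SU - SV + F) ≡ I + B + SV - SU
    rearrange = solve-∀

  forcing-constraint-holds : ∀ S {u v} → adj G u v ≡ true →
    ⟦ S u ⟧ℕ ℕ.≤ ⟦ isForced S v ⟧ℕ ℕ.+ blockers S u v ℕ.+ ⟦ S v ⟧ℕ
  forcing-constraint-holds S {u} {v} auv = begin
    ⟦ S u ⟧ℕ
      ≤⟨ ⟦⟧ℕ-cover (S u) (S v) (adj G u v) (allB (unblocked S u v)) auv ⟩
    ⟦ canForce G S u v ⟧ℕ ℕ.+ ⟦ not (allB (unblocked S u v)) ⟧ℕ ℕ.+ ⟦ S v ⟧ℕ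
      ≤⟨ ℕP.+-monoˡ-≤ ⟦ S v ⟧ℕ (ℕP.+-mono-≤ (⟦⟧ℕ-mono (anyB-intro (λ u′ → canForce G S u′ v) u))
                                            (⟦not-allB⟧≤count (unblocked S u v))) ⟩
    ⟦ isForced S v ⟧ℕ ℕ.+ blockers S u v ℕ.+ ⟦ S v ⟧ℕ
      ∎
    where open ℕP.≤-Reasoning

  forcing-constraint-forces : ∀ S {u v i} → canForce G S u v ≡ true →
    ⟦ S u ⟧ℕ ℕ.≤ i ℕ.+ blockers S u v ℕ.+ ⟦ S v ⟧ℕ → 1 ℕ.≤ i
  forcing-constraint-forces S {u} {v} {i} cf bound = begin
    1                                  ≡⟨ cong ⟦_⟧ℕ filled ⟨
    ⟦ S u ⟧ℕ                           ≤⟨ bound ⟩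
    i ℕ.+ blockers S u v ℕ.+ ⟦ S v ⟧ℕ  ≡⟨ cong₂ (λ b s → i ℕ.+ b ℕ.+ s) no-blockers (cong ⟦_⟧ℕ unfilled) ⟩
    i ℕ.+ 0 ℕ.+ 0                      ≡⟨ trans (ℕP.+-identityʳ _) (ℕP.+-identityʳ i) ⟩
    i                                  ∎
    where
    open ℕP.≤-Reasoning
    open Forcing (canForce⇒ S u v cf)
    no-blockers : blockers S u v ≡ 0
    no-blockers = allB⇒count≡0 (unblocked S u v) allUnblocked

module Trajectory {n : ℕ} (G : Graph n) (x : XVar G) (x-step : ∀ t → cur G x t ≗ step G (prev G x t)) where
  open ZeroForcing G

  C : VSet n
  C = x zero

  x≗iter : ∀ k → x k ≗ iter G (toℕ k) C
  x≗iter = step-sequence≗iter x x-step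

  prev≗iter : ∀ t → prev G x t ≗ iter G (toℕ t) C
  prev≗iter t v = trans (x≗iter (inject₁ t) v) (cong (λ k → iter G k C v) (FinP.toℕ-inject₁ t))

  last≗iter-T : x (fromℕ (T G)) ≗ iter G (T G) C
  last≗iter-T v = trans (x≗iter (fromℕ (T G)) v) (cong (λ k → iter G k C v) (FinP.toℕ-fromℕ (T G)))

  increment : Fin (T G) → ℤ
  increment t = sumℤ (λ v → ⟦ cur G x t v ⟧ - ⟦ prev G x t v ⟧)

  increment≡ : ∀ t → increment t ≡ + card (isForced (prev G x t))
  increment≡ t = trans (sumℤ-cong gain) (sumℤ-pos (λ v → ⟦ isForced P v ⟧ℕ))
    where
    open ≡-Reasoning
    P : VSet n
    P = prev G x t
    gain : ∀ v → ⟦ cur G x t v ⟧ - ⟦ P v ⟧ ≡ + ⟦ isForced P v ⟧ℕ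
    gain v = begin
      ⟦ cur G x t v ⟧ - ⟦ P v ⟧                          ≡⟨ cong₂ _-_ (⟦⟧≡+⟦⟧ℕ (cur G x t v)) (⟦⟧≡+⟦⟧ℕ (P v)) ⟩
      + ⟦ cur G x t v ⟧ℕ - + ⟦ P v ⟧ℕ                    ≡⟨ cong (λ b → + ⟦ b ⟧ℕ - + ⟦ P v ⟧ℕ) (x-step t v) ⟩
      + ⟦ step G P v ⟧ℕ - + ⟦ P v ⟧ℕ                     ≡⟨ cong (λ k → + k - + ⟦ P v ⟧ℕ) (⟦step⟧ℕ P v) ⟩
      + (⟦ P v ⟧ℕ ℕ.+ ⟦ isForced P v ⟧ℕ) - + ⟦ P v ⟧ℕ    ≡⟨ +[m+n]-+m ⟦ P v ⟧ℕ _ ⟩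
      + ⟦ isForced P v ⟧ℕ                                ∎

  unfinished⇒forcing : AllFilled (iter G (T G) C) → ∀ t → allB (prev G x t) ≡ false →
    ∃ λ v → isForced (prev G x t) v ≡ true
  unfinished⇒forcing C-full t unfinished with progress {t = toℕ t} (T G , C-full) not-full
    where
    not-full : ¬ AllFilled (iter G (toℕ t) C)
    not-full full = BoolP.not-¬ unfinished (allB-intro (prev G x t) (λ v → trans (prev≗iter t v) (full v)))
  ... | v , unfilled , filled-next =
    v , newly-filled⇒isForced (prev G x t) v (trans (prev≗iter t v) unfilled)
          (trans (sym (x-step t v)) (trans (x≗iter (suc t) v) filled-next))

  increment-constraints⇔ : AllFilled (iter G (T G) C) → ∀ t b →
    (increment t ≤ + n * ⟦ b ⟧ × ⟦ b ⟧ ≤ increment t) ⇔ b ≡ not (allB (prev G x t))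
  increment-constraints⇔ C-full t b =
    subst (λ Δ → (Δ ≤ + n * ⟦ b ⟧ × ⟦ b ⟧ ≤ Δ) ⇔ b ≡ not (allB P)) (sym (increment≡ t))
          (indicator-sandwich b (not (allB P)) none-forced some-forced)
    where
    P : VSet n
    P = prev G x t
    none-forced : not (allB P) ≡ false → card (isForced P) ≡ 0
    none-forced finished = sumℕ-zero λ v →
      cong ⟦_⟧ℕ (filled⇒¬isForced P v (allB-elim P (BoolP.not-injective {allB P} {true} finished) v))
    some-forced : not (allB P) ≡ true → 1 ℕ.≤ card (isForced P) × card (isForced P) ℕ.≤ n
    some-forced unfinished =
      let v , forced = unfinished⇒forcing C-full t (BoolP.not-injective {allB P} {false} unfinished)
      in 1≤card (isForced P) v forced , card≤n (isForced P)

  unfilledSteps≡ : sumℕ (λ t → ⟦ not (allB (prev G x t)) ⟧ℕ) ≡ unfilledSteps C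
  unfilledSteps≡ = sumℕ-cong (λ t → cong (⟦_⟧ℕ ∘ not) (allB-cong (prev≗iter t)))

  objective≡ : ∀ z → (∀ t → z t ≡ not (allB (prev G x t))) →
    objective G x z ≡ + (2 ℕ.* T G) * + card C - + unfilledSteps C
  objective≡ z z≡ = cong₂ (λ a b → + (2 ℕ.* T G) * a - b) (sumℤ-⟦⟧ C)
    (trans (sumℤ-⟦⟧ z) (cong +_ (trans (sumℕ-cong (cong ⟦_⟧ℕ ∘ z≡)) unfilledSteps≡)))

module FeasibleSolution {n : ℕ} {G : Graph n} {x : XVar G} {y : YVar G} {z : ZVar G}
                        (feasible : Feasible G x y z) where
  open Feasible feasible
  open ZeroForcing G

  inflowℕ : Fin (T G) → Fin n → ℕ
  inflowℕ t v = sumℕ (λ u → ⟦ adj G u v ∧ y t u v ⟧ℕ)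

  inflow≡ : ∀ t v → inflow G y t v ≡ + inflowℕ t v
  inflow≡ t v = trans (sumℤ-cong (λ u → if-⟦⟧ (adj G u v) (y t u v)))
                      (sumℤ-pos (λ u → ⟦ adj G u v ∧ y t u v ⟧ℕ))

  cur≡prev+inflow : ∀ t v → ⟦ cur G x t v ⟧ℕ ≡ ⟦ prev G x t v ⟧ℕ ℕ.+ inflowℕ t v
  cur≡prev+inflow t v = ℤP.+-injective (begin
    + ⟦ cur G x t v ⟧ℕ                     ≡⟨ ⟦⟧≡+⟦⟧ℕ (cur G x t v) ⟨
    ⟦ cur G x t v ⟧                        ≡⟨ c4 t v ⟩
    ⟦ prev G x t v ⟧ + inflow G y t v      ≡⟨ cong₂ _+_ (⟦⟧≡+⟦⟧ℕ (prev G x t v)) (inflow≡ t v) ⟩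
    + ⟦ prev G x t v ⟧ℕ + + inflowℕ t v    ≡⟨ ℤP.pos-+ ⟦ prev G x t v ⟧ℕ (inflowℕ t v) ⟨
    + (⟦ prev G x t v ⟧ℕ ℕ.+ inflowℕ t v)  ∎)
    where open ≡-Reasoning

  newly-filled⇒inflow : ∀ t v → prev G x t v ≡ false → cur G x t v ≡ true → 1 ℕ.≤ inflowℕ t v
  newly-filled⇒inflow t v unfilled filled = ℕP.≤-reflexive (begin
    1                                      ≡⟨ cong ⟦_⟧ℕ filled ⟨
    ⟦ cur G x t v ⟧ℕ                       ≡⟨ cur≡prev+inflow t v ⟩
    ⟦ prev G x t v ⟧ℕ ℕ.+ inflowℕ t v      ≡⟨ cong (λ b → ⟦ b ⟧ℕ ℕ.+ inflowℕ t v) unfilled ⟩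
    inflowℕ t v                            ∎)
    where open ≡-Reasoning

  inflow⇒arc : ∀ t v → 1 ℕ.≤ inflowℕ t v → ∃ λ u → adj G u v ≡ true × y t u v ≡ true
  inflow⇒arc t v 1≤inflow =
    let u , 1≤term = sumℕ-positive (λ u → ⟦ adj G u v ∧ y t u v ⟧ℕ) 1≤inflow
    in u , ∧≡true (1≤⟦⟧ℕ⇒true 1≤term)

  arc⇒canForce : ∀ t u v → adj G u v ≡ true → y t u v ≡ true → prev G x t v ≡ false →
    canForce G (prev G x t) u v ≡ true
  arc⇒canForce t u v auv yuv unfilled = canForce-intro (prev G x t) u v
    (⟦⟧-mono⁻¹ (c2 t u v auv) yuv) unfilled auv (λ w auw w≢v → ⟦⟧-mono⁻¹ (c3 t u v w auv auw w≢v) yuv)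

  canForce⇒inflow : ∀ t u v → canForce G (prev G x t) u v ≡ true → 1 ℕ.≤ inflowℕ t v
  canForce⇒inflow t u v cf = forcing-constraint-forces (prev G x t) cf
    (Equivalence.to (forcing-constraint⇔ (prev G x t) (inflow G y t v) (inflowℕ t v) (inflow≡ t v) auv)
                    (c5 t u v auv))
    where
    auv : adj G u v ≡ true
    auv = Forcing.adjacent (canForce⇒ (prev G x t) u v cf)

  x-step : ∀ t → cur G x t ≗ step G (prev G x t)
  x-step t v = true⇔true⇒≡ filled⇒stepped stepped⇒filled
    where
    P : VSet n
    P = prev G x t
    filled-if : 1 ℕ.≤ ⟦ P v ⟧ℕ ℕ.+ inflowℕ t v → cur G x t v ≡ true
    filled-if = 1≤⟦⟧ℕ⇒true ∘ subst (1 ℕ.≤_) (sym (cur≡prev+inflow t v))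
    filled⇒stepped : cur G x t v ≡ true → step G P v ≡ true
    filled⇒stepped filled with P v BoolP.≟ true
    ... | yes Pv  = step-inflationary P v Pv
    ... | no  ¬Pv with inflow⇒arc t v (newly-filled⇒inflow t v (BoolP.¬-not ¬Pv) filled)
    ...   | u , auv , yuv = isForced⇒stepped P v
              (anyB-intro (λ u′ → canForce G P u′ v) u (arc⇒canForce t u v auv yuv (BoolP.¬-not ¬Pv)))
    stepped⇒filled : step G P v ≡ true → cur G x t v ≡ true
    stepped⇒filled stepped with ∨≡true {P v} stepped
    ... | inj₁ Pv     = filled-if (ℕP.≤-trans (ℕP.≤-reflexive (cong ⟦_⟧ℕ (sym Pv))) (ℕP.m≤m+n _ _))
    ... | inj₂ forced =
      let u , cf = anyB-elim (λ u → canForce G P u v) forced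
      in filled-if (ℕP.≤-trans (canForce⇒inflow t u v cf) (ℕP.m≤n+m _ _))

  open Trajectory G x x-step public

  C-full : AllFilled (iter G (T G) C)
  C-full v = trans (sym (last≗iter-T v))
    (⟦⟧≡+1⇒true (trans (telescope (λ k → ⟦ x k v ⟧) (λ t → inflow G y t v) (λ t → c4 t v)) (c1 v)))

  z≡unfinished : ∀ t → z t ≡ not (allB (prev G x t))
  z≡unfinished t = Equivalence.to (increment-constraints⇔ C-full t (z t)) (c6 t , c7 t)

  sumZ≡unfilledSteps : sumZ G z ≡ unfilledSteps C
  sumZ≡unfilledSteps = trans (sumℕ-cong (cong ⟦_⟧ℕ ∘ z≡unfinished)) unfilledSteps≡

  objective-value : objective G x z ≡ + (2 ℕ.* T G) * + card C - + unfilledSteps C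
  objective-value = objective≡ z z≡unfinished

module ForcingSolution {n : ℕ} (G : Graph n) (D : VSet n) (D-zfs : IsZFS G D) where
  open ZeroForcing G

  x : XVar G
  x k = iter G (toℕ k) D

  x-step : ∀ t → cur G x t ≗ step G (prev G x t)
  x-step t v = cong (λ k → step G (iter G k D) v) (sym (FinP.toℕ-inject₁ t))

  -- Several vertices may be able to force v; using only the first keeps the inflow of v at most 1.
  y : YVar G
  y t u v = firstTrue (λ u′ → canForce G (prev G x t) u′ v) u

  z : ZVar G
  z t = not (allB (prev G x t))

  open Trajectory G x x-step

  y⇒forcing : ∀ t u v → y t u v ≡ true → Forcing (prev G x t) u v
  y⇒forcing t u v = canForce⇒ (prev G x t) u v ∘ firstTrue⇒true (λ u′ → canForce G (prev G x t) u′ v) u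

  inflow≡ : ∀ t v → inflow G y t v ≡ + ⟦ isForced (prev G x t) v ⟧ℕ
  inflow≡ t v = begin
    inflow G y t v                            ≡⟨ sumℤ-cong (λ u → if-⟦⟧ (adj G u v) (y t u v)) ⟩
    sumℤ (λ u → + ⟦ adj G u v ∧ y t u v ⟧ℕ)   ≡⟨ sumℤ-cong (λ u → cong (+_ ∘ ⟦_⟧ℕ) (∧-absorbˡ (y⇒arc u))) ⟩
    sumℤ (λ u → + ⟦ y t u v ⟧ℕ)               ≡⟨ sumℤ-pos (λ u → ⟦ y t u v ⟧ℕ) ⟩
    + sumℕ (λ u → ⟦ y t u v ⟧ℕ)               ≡⟨ cong +_ (sumℕ-firstTrue (λ u′ → canForce G (prev G x t) u′ v)) ⟩
    + ⟦ isForced (prev G x t) v ⟧ℕ            ∎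
    where
    open ≡-Reasoning
    y⇒arc : ∀ u → y t u v ≡ true → adj G u v ≡ true
    y⇒arc u = Forcing.adjacent ∘ y⇒forcing t u v

  cur≡prev+inflow : ∀ t v → ⟦ cur G x t v ⟧ ≡ ⟦ prev G x t v ⟧ + inflow G y t v
  cur≡prev+inflow t v = begin
    ⟦ cur G x t v ⟧                             ≡⟨ ⟦⟧≡+⟦⟧ℕ (cur G x t v) ⟩
    + ⟦ cur G x t v ⟧ℕ                          ≡⟨ cong (+_ ∘ ⟦_⟧ℕ) (x-step t v) ⟩
    + ⟦ step G P v ⟧ℕ                           ≡⟨ cong +_ (⟦step⟧ℕ P v) ⟩
    + (⟦ P v ⟧ℕ ℕ.+ ⟦ isForced P v ⟧ℕ)          ≡⟨ ℤP.pos-+ ⟦ P v ⟧ℕ _ ⟩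
    + ⟦ P v ⟧ℕ + + ⟦ isForced P v ⟧ℕ            ≡⟨ cong₂ _+_ (⟦⟧≡+⟦⟧ℕ (P v)) (inflow≡ t v) ⟨
    ⟦ P v ⟧ + inflow G y t v                    ∎
    where
    open ≡-Reasoning
    P : VSet n
    P = prev G x t

  D-full : AllFilled (iter G (T G) D)
  D-full = zfs-fills-within-T D-zfs

  filled-exactly-once : ∀ v → ⟦ x zero v ⟧ + sumℤ (λ t → inflow G y t v) ≡ + 1
  filled-exactly-once v =
    trans (sym (telescope (λ k → ⟦ x k v ⟧) (λ t → inflow G y t v) (λ t → cur≡prev+inflow t v)))
          (cong ⟦_⟧ (trans (last≗iter-T v) (D-full v)))

  feasible : Feasible G x y z
  feasible = record
    { c1 = filled-exactly-once
    ; c2 = λ t u v _ → ⟦⟧-mono (Forcing.filled ∘ y⇒forcing t u v)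
    ; c3 = λ t u v w _ auw w≢v → ⟦⟧-mono λ yuv →
             allUnblocked⇒filled (prev G x t) u v (Forcing.allUnblocked (y⇒forcing t u v yuv)) w auw w≢v
    ; c4 = cur≡prev+inflow
    ; c5 = λ t u v auv → Equivalence.from (forcing-constraint⇔ (prev G x t) _ _ (inflow≡ t v) auv)
                                          (forcing-constraint-holds (prev G x t) auv)
    ; c6 = λ t → proj₁ (increment-constraints t)
    ; c7 = λ t → proj₂ (increment-constraints t)
    }
    where
    increment-constraints : ∀ t → increment t ≤ + n * ⟦ z t ⟧ × ⟦ z t ⟧ ≤ increment t
    increment-constraints t = Equivalence.from (increment-constraints⇔ D-full t (z t)) refl

  objective-value : objective G x z ≡ + (2 ℕ.* T G) * + card D - + unfilledSteps D
  objective-value = objective≡ z (λ _ → refl)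

module Optimality {n : ℕ} {G : Graph n} {x : XVar G} {y : YVar G} {z : ZVar G}
                  (optimal : Optimal G x y z) where
  open ZeroForcing G
  open FeasibleSolution (proj₁ optimal) public

  C-zfs : IsZFS G C
  C-zfs = T G , C-full

  weighted-comparison : ∀ D → IsZFS G D →
    2 ℕ.* T G ℕ.* card C ℕ.+ unfilledSteps D ℕ.≤ 2 ℕ.* T G ℕ.* card D ℕ.+ unfilledSteps C
  weighted-comparison D D-zfs =
    objective-≤⇒ (2 ℕ.* T G) (card C) (unfilledSteps C) (card D) (unfilledSteps D)
      (subst₂ _≤_ objective-value FS.objective-value (proj₂ optimal FS.x FS.y FS.z FS.feasible))
    where
    module FS = ForcingSolution G D D-zfs

  -- For T = 0 the weight 2T vanishes, but then every zero forcing set is already all of V.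
  C-minimal : ∀ D → IsZFS G D → card C ℕ.≤ card D
  C-minimal D D-zfs with T G ℕP.≟ 0
  ... | yes T≡0 = ℕP.≤-trans (card≤n C) (ℕP.≤-reflexive (sym (card-full D D-full)))
    where
    D-full : AllFilled D
    D-full = subst (λ k → AllFilled (iter G k D)) T≡0 (zfs-fills-within-T D-zfs)
  ... | no T≢0 = weighted-≤ (2 ℕ.* T G) (ℕP.≤-<-trans (card≤n _) T<2T) (weighted-comparison D D-zfs)
    where
    T<2T : T G ℕ.< 2 ℕ.* T G
    T<2T = ℕP.m<m+n (T G) (ℕP.≤-trans (ℕP.n≢0⇒n>0 T≢0) (ℕP.m≤m+n (T G) 0))

  unfilledSteps-maximal : ∀ D → IsMinZFS G D → unfilledSteps D ℕ.≤ unfilledSteps C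
  unfilledSteps-maximal D (D-zfs , D-minimal) = ℕP.+-cancelˡ-≤ (2 ℕ.* T G ℕ.* card C) _ _
    (subst (λ c → 2 ℕ.* T G ℕ.* card C ℕ.+ unfilledSteps D ℕ.≤ 2 ℕ.* T G ℕ.* c ℕ.+ unfilledSteps C)
           (ℕP.≤-antisym (D-minimal C C-zfs) (C-minimal D D-zfs)) (weighted-comparison D D-zfs))

corollary4p6 : (n : ℕ) (G : Graph n) (x : XVar G) (y : YVar G) (z : ZVar G) →
    Optimal G x y z →
    IsMinZFS G (λ v → x zero v) × IsPT G (sumZ G z) × IsPt G (λ v → x zero v) (sumZ G z)
corollary4p6 n G x y z optimal = C-minimum , ((C , C-minimum , C-pt) , PT-maximal) , C-pt
  where
  open ZeroForcing G
  open Optimality optimal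

  C-minimum : IsMinZFS G C
  C-minimum = C-zfs , C-minimal

  C-pt : IsPt G C (sumZ G z)
  C-pt = subst (IsPt G C) (sym sumZ≡unfilledSteps) (isPt-unfilledSteps C-full)

  PT-maximal : ∀ D k → IsMinZFS G D → IsPt G D k → k ℕ.≤ sumZ G z
  PT-maximal D k D-minimum D-pt =
    subst₂ ℕ._≤_ (pt-unique (isPt-unfilledSteps (zfs-fills-within-T (proj₁ D-minimum))) D-pt)
                 (sym sumZ≡unfilledSteps) (unfilledSteps-maximal D D-minimum)
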